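{- Let $f\colon\{0,1\}^n\to\{0,1,\perp\}$ be a partial function, $F(x,y)=f(x\oplus y)$, and let $h\colon\{0,1\}^n\to\{0,1\}^t$, $\varphi\colon\{0,1\}^t\times\{0,1\}^n\to\{0,1\}$ be total functions with $\varphi(h(x),y)=F(x,y)$ for all $(x,y)\in\operatorname{Dom}(F)$. Suppose the partition of $\{0,1\}^n$ into the classes $h^{ -1}(a)$, $a\in\{0,1\}^t$, is not the partition into the cosets of some $(n-t)$-dimensional linear subspace of $\mathbb F_2^n$. Then the set $D$ of good shifts for $h$ contains at least $n-t+1$ linearly independent vectors.
   Context: $\{0,1\}^n$ is identified with $\mathbb F_2^n$, $\oplus$ is bitwise XOR; $\operatorname{Dom}(f)=f^{ -1}(\{0,1\})$, $\operatorname{Dom}(F)=\{(x,y):x\oplus y\in\operatorname{Dom}(f)\}$. A vector $\Delta$ is a good shift for $h$ if there exist $x,y$ with $x\oplus y=\Delta$ and $h(x)=h(y)$. -}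

module Defs where

open import Data.Nat using (ℕ; zero; suc)
open import Data.Bool using (Bool; true; false; _xor_)
open import Data.Vec using (Vec; []; _∷_; zipWith; replicate)
open import Data.Vec.Relation.Unary.All using (All)
open import Data.Maybe using (Maybe; just)
open import Data.Product using (Σ; ∃; _×_)
open import Relation.Binary.PropositionalEquality using (_≡_)

BitVec : ℕ → Set
BitVec n = Vec Bool n

_⊕_ : ∀ {n} → BitVec n → BitVec n → BitVec n
_⊕_ = zipWith _xor_

infixl 6 _⊕_

zeroV : ∀ {n} → BitVec n
zeroV = replicate _ false

lincomb : ∀ {n k} → Vec Bool k → Vec (BitVec n) k → BitVec n
lincomb [] [] = zeroV
lincomb (true ∷ cs) (v ∷ vs) = v ⊕ lincomb cs vs
lincomb (false ∷ cs) (v ∷ vs) = lincomb cs vs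

LinIndep : ∀ {n k} → Vec (BitVec n) k → Set
LinIndep {n} {k} vs = (c : Vec Bool k) → lincomb c vs ≡ zeroV → c ≡ replicate k false

InSpan : ∀ {n k} → Vec (BitVec n) k → BitVec n → Set
InSpan {n} {k} B v = Σ (Vec Bool k) λ c → lincomb c B ≡ v

-- Dom(f) encoded via Maybe: f x ≡ just b means x ∈ Dom(f) with value b,
-- f x ≡ nothing means f(x) = ⊥.
-- h and φ compute F on Dom(F), F(x,y) = f(x ⊕ y)
Computes : ∀ {n t} → (BitVec n → Maybe Bool) → (BitVec n → BitVec t)
         → (BitVec t → BitVec n → Bool) → Set
Computes {n} f h φ = (x y : BitVec n) (b : Bool) → f (x ⊕ y) ≡ just b → φ (h x) y ≡ b

IsCosetPartition : ∀ {n t d} → (BitVec n → BitVec t) → Vec (BitVec n) d → Set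
IsCosetPartition {n} h B =
  (x y : BitVec n) → (h x ≡ h y → InSpan B (x ⊕ y)) × (InSpan B (x ⊕ y) → h x ≡ h y)

IsCosetPartitionOfDim : ∀ {n t} → (BitVec n → BitVec t) → ℕ → Set
IsCosetPartitionOfDim {n} h d =
  Σ (Vec (BitVec n) d) λ B → LinIndep B × IsCosetPartition h B

GoodShift : ∀ {n t} → (BitVec n → BitVec t) → BitVec n → Set
GoodShift {n} h Δ = Σ (BitVec n) λ x → Σ (BitVec n) λ y → (x ⊕ y ≡ Δ) × (h x ≡ h y)

-- Collect good shifts greedily, each outside the span V of the k found so far.
-- If no good shift lies outside V, every class h⁻¹(a) sits inside a coset of V;
-- recording for each x its class h x and the coordinates in V of x ⊕ rep(h x),
-- where rep picks a point of each class, gives an injection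
-- {0,1}ⁿ → {0,1}^(k+t), so n ≤ k + t. While k + t ≤ n this injection is a
-- bijection, which forces every coset of V to be a single class: h would be
-- the coset partition of the (n − t)-dimensional space V, which is excluded.
-- Hence the collection keeps growing until k + t > n.
module Submission where

open import Defs
open import Algebra.Bundles using (CommutativeSemigroup)
open import Algebra.Definitions using (Associative; Commutative; LeftIdentity; RightIdentity)
import Algebra.Properties.CommutativeSemigroup as CommutativeSemigroupProperties
open import Data.Bool using (Bool; true; false)
open import Data.Bool.Properties using (xor-assoc; xor-comm; xor-identityˡ; xor-identityʳ; xor-same)
import Data.Bool.Properties as Bool
open import Data.Empty using (⊥; ⊥-elim)
open import Data.Fin using (Fin; punchOut)
import Data.Fin as Fin
open import Data.Fin.Properties using (2↔Bool; *↔×; injective⇒≤; punchOut-injective)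
  renaming (any? to Fin-any?; _≟_ to _≟ᶠ_)
open import Data.Maybe using (Maybe)
open import Data.Nat using (ℕ; zero; suc; _+_; _∸_; _≤_; _<_; _≤?_; _^_; z≤n; s≤s)
open import Data.Nat.Properties using (≤-antisym; ≤-reflexive; ≤-trans; ≰⇒>; <⇒≤; <-irrefl; <⇒≱; ≮⇒≥)
open import Data.Nat.Properties using (^-monoʳ-≤; ^-monoʳ-<; m≤n⇒m≤1+n; m∸n+n≡m)
open import Data.Product using (Σ; ∃; _×_; _,_; proj₁; proj₂; uncurry)
open import Data.Product.Function.NonDependent.Propositional using (_×-↔_)
open import Data.Vec using (Vec; []; _∷_; _++_)
open import Data.Vec.Properties using (≡-dec; ++-injective)
open import Data.Vec.Properties using (zipWith-assoc; zipWith-comm; zipWith-identityˡ; zipWith-identityʳ)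
open import Data.Vec.Relation.Unary.All using (All; []; _∷_)
open import Function using (_∘_; _↔_; _↣_; Inverse; Injection; mk↔ₛ′; mk↣)
open import Function.Definitions using (Injective; StrictlySurjective)
open import Function.Properties.Injection using (↣-trans)
open import Function.Properties.Inverse using (↔-sym; ↔-trans; ↔⇒↣)
open import Relation.Binary.Definitions using (DecidableEquality)
open import Relation.Binary.PropositionalEquality
  using (_≡_; refl; sym; trans; cong; cong₂; subst; module ≡-Reasoning)
import Relation.Binary.PropositionalEquality as ≡
open import Relation.Nullary using (¬_; Dec; yes; no; ¬?; contradiction)
open import Relation.Nullary.Decidable using (_×-dec_; map′; decidable-stable)
open import Relation.Unary using (Decidable)

⊕-assoc : ∀ {n} → Associative _≡_ (_⊕_ {n})
⊕-assoc = zipWith-assoc xor-assoc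

⊕-comm : ∀ {n} → Commutative _≡_ (_⊕_ {n})
⊕-comm = zipWith-comm xor-comm

⊕-identityˡ : ∀ {n} → LeftIdentity _≡_ zeroV (_⊕_ {n})
⊕-identityˡ = zipWith-identityˡ xor-identityˡ

⊕-identityʳ : ∀ {n} → RightIdentity _≡_ zeroV (_⊕_ {n})
⊕-identityʳ = zipWith-identityʳ xor-identityʳ

⊕-self : ∀ {n} (x : BitVec n) → x ⊕ x ≡ zeroV
⊕-self []      = refl
⊕-self (a ∷ x) = cong₂ _∷_ (xor-same a) (⊕-self x)

⊕-commutativeSemigroup : ℕ → CommutativeSemigroup _ _
⊕-commutativeSemigroup n = record
  { _∙_ = _⊕_ {n}
  ; isCommutativeSemigroup = record
    { isSemigroup = record
      { isMagma = record { isEquivalence = ≡.isEquivalence ; ∙-cong = cong₂ _⊕_ }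
      ; assoc   = ⊕-assoc
      }
    ; comm = ⊕-comm
    }
  }

module ⊕-Properties {n} = CommutativeSemigroupProperties (⊕-commutativeSemigroup n)

⊕-cancelʳ : ∀ {n} (x y z : BitVec n) → x ⊕ z ≡ y ⊕ z → x ≡ y
⊕-cancelʳ x y z x⊕z≡y⊕z = begin
  x            ≡⟨ ⊕-undo x ⟨
  (x ⊕ z) ⊕ z  ≡⟨ cong (_⊕ z) x⊕z≡y⊕z ⟩
  (y ⊕ z) ⊕ z  ≡⟨ ⊕-undo y ⟩
  y            ∎
  where
  open ≡-Reasoning
  ⊕-undo : ∀ u → (u ⊕ z) ⊕ z ≡ u
  ⊕-undo u = trans (⊕-assoc u z z) (trans (cong (u ⊕_) (⊕-self z)) (⊕-identityʳ u))

⊕-cancel-common : ∀ {n} (x y z : BitVec n) → (x ⊕ y) ⊕ (x ⊕ z) ≡ y ⊕ z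
⊕-cancel-common x y z = begin
  (x ⊕ y) ⊕ (x ⊕ z)  ≡⟨ ⊕-Properties.interchange x y x z ⟩
  (x ⊕ x) ⊕ (y ⊕ z)  ≡⟨ cong (_⊕ (y ⊕ z)) (⊕-self x) ⟩
  zeroV ⊕ (y ⊕ z)    ≡⟨ ⊕-identityˡ (y ⊕ z) ⟩
  y ⊕ z              ∎
  where open ≡-Reasoning

⊕≡zero⇒≡ : ∀ {n} {x y : BitVec n} → x ⊕ y ≡ zeroV → x ≡ y
⊕≡zero⇒≡ {x = x} {y} x⊕y≡0 = ⊕-cancelʳ x y y (trans x⊕y≡0 (sym (⊕-self y)))

lincomb-⊕ : ∀ {n k} (c c′ : Vec Bool k) (vs : Vec (BitVec n) k) →
            lincomb (c ⊕ c′) vs ≡ lincomb c vs ⊕ lincomb c′ vs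
lincomb-⊕ []          []           []       = sym (⊕-identityʳ zeroV)
lincomb-⊕ (false ∷ c) (false ∷ c′) (v ∷ vs) = lincomb-⊕ c c′ vs
lincomb-⊕ (true ∷ c)  (false ∷ c′) (v ∷ vs) =
  trans (cong (v ⊕_) (lincomb-⊕ c c′ vs)) (sym (⊕-assoc v _ _))
lincomb-⊕ (false ∷ c) (true ∷ c′)  (v ∷ vs) =
  trans (cong (v ⊕_) (lincomb-⊕ c c′ vs)) (⊕-Properties.x∙yz≈y∙xz v _ _)
lincomb-⊕ (true ∷ c)  (true ∷ c′)  (v ∷ vs) =
  trans (lincomb-⊕ c c′ vs) (sym (⊕-cancel-common v _ _))

LinIndep-[] : ∀ {n} → LinIndep {n} []
LinIndep-[] [] _ = refl

LinIndep-∷ : ∀ {n k} {vs : Vec (BitVec n) k} {d : BitVec n} →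
             LinIndep vs → ¬ InSpan vs d → LinIndep (d ∷ vs)
LinIndep-∷ independent d∉span (true ∷ c)  d⊕w≡0 = contradiction (c , sym (⊕≡zero⇒≡ d⊕w≡0)) d∉span
LinIndep-∷ independent d∉span (false ∷ c) w≡0   = cong (false ∷_) (independent c w≡0)

BitVec↔Fin : ∀ m → BitVec m ↔ Fin (2 ^ m)
BitVec↔Fin zero    =
  mk↔ₛ′ (λ _ → Fin.zero) (λ _ → []) (λ { Fin.zero → refl ; (Fin.suc ()) }) (λ { [] → refl })
BitVec↔Fin (suc m) = ↔-trans Vec↔× (↔-trans (↔-sym 2↔Bool ×-↔ BitVec↔Fin m) (↔-sym *↔×))
  where
  Vec↔× : BitVec (suc m) ↔ (Bool × BitVec m)
  Vec↔× = mk↔ₛ′ (λ { (b ∷ v) → b , v }) (λ (b , v) → b ∷ v) (λ _ → refl) (λ { (_ ∷ _) → refl })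

any? : ∀ {m p} {P : BitVec m → Set p} → Decidable P → Dec (∃ P)
any? {m} {P = P} P? =
  map′ (λ (i , p) → from i , p) (λ (v , p) → to v , subst P (sym (strictlyInverseʳ v)) p)
       (Fin-any? (P? ∘ from))
  where open Inverse (BitVec↔Fin m)

_≟_ : ∀ {m} → DecidableEquality (BitVec m)
_≟_ = ≡-dec Bool._≟_

InSpan? : ∀ {n k} (vs : Vec (BitVec n) k) v → Dec (InSpan vs v)
InSpan? vs v = any? (λ c → lincomb c vs ≟ v)

Fin-injective⇒strictlySurjective : ∀ {m n} {f : Fin m → Fin n} →
                                   Injective _≡_ _≡_ f → n ≤ m → StrictlySurjective _≡_ f
Fin-injective⇒strictlySurjective {n = suc _} {f} f-injective n≤m j with Fin-any? (λ i → f i ≟ᶠ j)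
... | yes j∈image = j∈image
... | no  j∉image = ⊥-elim (<-irrefl refl (≤-trans n≤m (injective⇒≤ punchOut∘f-injective)))
  where
  j≢f : ∀ i → j ≡ f i → ⊥
  j≢f i j≡fi = j∉image (i , sym j≡fi)
  punchOut∘f-injective : Injective _≡_ _≡_ (λ i → punchOut (j≢f i))
  punchOut∘f-injective eq = f-injective (punchOut-injective (j≢f _) (j≢f _) eq)

^-cancelʳ-≤ : ∀ m {a b} → 1 < m → m ^ a ≤ m ^ b → a ≤ b
^-cancelʳ-≤ m 1<m mᵃ≤mᵇ = ≮⇒≥ (λ b<a → <⇒≱ (^-monoʳ-< m 1<m b<a) mᵃ≤mᵇ)

module _ {a b} {f : BitVec a → BitVec b} (f-injective : Injective _≡_ _≡_ f) where

  private
    f↓ : Fin (2 ^ a) ↣ Fin (2 ^ b)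
    f↓ = ↣-trans (↔⇒↣ (↔-sym (BitVec↔Fin a))) (↣-trans (mk↣ f-injective) (↔⇒↣ (BitVec↔Fin b)))

  BitVec-injective⇒≤ : a ≤ b
  BitVec-injective⇒≤ = ^-cancelʳ-≤ 2 (s≤s (s≤s z≤n)) (injective⇒≤ (Injection.injective f↓))

  BitVec-injective⇒strictlySurjective : b ≤ a → StrictlySurjective _≡_ f
  BitVec-injective⇒strictlySurjective b≤a w
    with i , f↓i≡w ← Fin-injective⇒strictlySurjective (Injection.injective f↓) (^-monoʳ-≤ 2 b≤a)
                                                       (Inverse.to (BitVec↔Fin b) w)
    = Inverse.from (BitVec↔Fin a) i , Injection.injective (↔⇒↣ (BitVec↔Fin b)) f↓i≡w

-- zeroV is a junk value: only representatives of non-empty classes are used.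
representative : ∀ {n t} → (BitVec n → BitVec t) → BitVec t → BitVec n
representative h a with any? (λ z → h z ≟ a)
... | yes (z , _) = z
... | no  _       = zeroV

representative-spec : ∀ {n t} (h : BitVec n → BitVec t) x → h (representative h (h x)) ≡ h x
representative-spec h x with any? (λ z → h z ≟ h x)
... | yes (_ , hz≡hx) = hz≡hx
... | no  ∄z          = contradiction (x , refl) ∄z

module ClassesInCosets {n t k} (h : BitVec n → BitVec t) (vs : Vec (BitVec n) k)
                       (class⊆coset : ∀ x y → h x ≡ h y → InSpan vs (x ⊕ y)) where

  private
    rep : BitVec n → BitVec n
    rep x = representative h (h x)

    rep-cong : ∀ {x y} → h x ≡ h y → rep x ≡ rep y
    rep-cong = cong (representative h)

  offset : BitVec n → Vec Bool k
  offset x = proj₁ (class⊆coset x (rep x) (sym (representative-spec h x)))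

  offset-spec : ∀ x → lincomb (offset x) vs ≡ x ⊕ rep x
  offset-spec x = proj₂ (class⊆coset x (rep x) (sym (representative-spec h x)))

  code : BitVec n → BitVec (k + t)
  code x = offset x ++ h x

  code-injective : Injective _≡_ _≡_ code
  code-injective {x} {y} code-x≡code-y
    with offset-x≡offset-y , hx≡hy ← ++-injective (offset x) (offset y) code-x≡code-y =
    ⊕-cancelʳ x y (rep x) (begin
      x ⊕ rep x              ≡⟨ offset-spec x ⟨
      lincomb (offset x) vs  ≡⟨ cong (λ c → lincomb c vs) offset-x≡offset-y ⟩
      lincomb (offset y) vs  ≡⟨ offset-spec y ⟩
      y ⊕ rep y              ≡⟨ cong (y ⊕_) (rep-cong hx≡hy) ⟨
      y ⊕ rep x              ∎)
    where open ≡-Reasoning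

  dim-≤ : n ≤ k + t
  dim-≤ = BitVec-injective⇒≤ code-injective

  -- The preimage under code of (offset x ⊕ c , h x) is y itself.
  coset⊆class : k + t ≤ n → ∀ x y → InSpan vs (x ⊕ y) → h x ≡ h y
  coset⊆class k+t≤n x y (c , c·vs≡x⊕y) =
    uncurry preimage-in-class
            (BitVec-injective⇒strictlySurjective code-injective k+t≤n (offset x ⊕ c ++ h x))
    where
    open ≡-Reasoning
    preimage-in-class : ∀ z → code z ≡ offset x ⊕ c ++ h x → h x ≡ h y
    preimage-in-class z code-z≡
      with offset-z≡ , hz≡hx ← ++-injective (offset z) (offset x ⊕ c) code-z≡ =
      trans (sym hz≡hx) (cong h (⊕-cancelʳ z y (rep x) (begin
        z ⊕ rep x                             ≡⟨ cong (z ⊕_) (rep-cong hz≡hx) ⟨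
        z ⊕ rep z                             ≡⟨ offset-spec z ⟨
        lincomb (offset z) vs                 ≡⟨ cong (λ c′ → lincomb c′ vs) offset-z≡ ⟩
        lincomb (offset x ⊕ c) vs             ≡⟨ lincomb-⊕ (offset x) c vs ⟩
        lincomb (offset x) vs ⊕ lincomb c vs  ≡⟨ cong₂ _⊕_ (offset-spec x) c·vs≡x⊕y ⟩
        (x ⊕ rep x) ⊕ (x ⊕ y)                 ≡⟨ ⊕-cancel-common x (rep x) y ⟩
        rep x ⊕ y                             ≡⟨ ⊕-comm (rep x) y ⟩
        y ⊕ rep x                             ∎)))

module _ {n t} {h : BitVec n → BitVec t}
         (notCosetPartition : (d : ℕ) → d + t ≡ n → ¬ IsCosetPartitionOfDim h d) where

  goodShift∉span : ∀ {k} {vs : Vec (BitVec n) k} → LinIndep vs → k + t ≤ n →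
                   ∃ λ Δ → GoodShift h Δ × ¬ InSpan vs Δ
  goodShift∉span {k} {vs} independent k+t≤n
    with any? (λ x → any? (λ y → h x ≟ h y ×-dec ¬? (InSpan? vs (x ⊕ y))))
  ... | yes (x , y , hx≡hy , x⊕y∉span) = x ⊕ y , (x , y , refl , hx≡hy) , x⊕y∉span
  ... | no  ∄pair = contradiction (vs , independent , partition) (notCosetPartition k k+t≡n)
    where
    class⊆coset : ∀ x y → h x ≡ h y → InSpan vs (x ⊕ y)
    class⊆coset x y hx≡hy =
      decidable-stable (InSpan? vs (x ⊕ y)) (λ x⊕y∉span → ∄pair (x , y , hx≡hy , x⊕y∉span))

    open ClassesInCosets h vs class⊆coset

    k+t≡n : k + t ≡ n
    k+t≡n = ≤-antisym k+t≤n dim-≤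

    partition : IsCosetPartition h vs
    partition x y = class⊆coset x y , coset⊆class (≤-reflexive k+t≡n) x y

  independentGoodShifts : ∀ k → k + t ≤ suc n →
                          Σ (Vec (BitVec n) k) λ vs → LinIndep vs × All (GoodShift h) vs
  independentGoodShifts zero    _ = [] , LinIndep-[] , []
  independentGoodShifts (suc k) (s≤s k+t≤n)
    with vs , independent , good ← independentGoodShifts k (m≤n⇒m≤1+n k+t≤n)
    with Δ , Δ-good , Δ∉span ← goodShift∉span independent k+t≤n
    = Δ ∷ vs , LinIndep-∷ independent Δ∉span , Δ-good ∷ good

lemma21 : (n t : ℕ) (f : BitVec n → Maybe Bool) (h : BitVec n → BitVec t)
    (φ : BitVec t → BitVec n → Bool) →
    Computes f h φ →
    ((d : ℕ) → d + t ≡ n → ¬ IsCosetPartitionOfDim h d) →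
    Σ ℕ λ k → Σ (Vec (BitVec n) k) λ vs →
    LinIndep vs × All (GoodShift h) vs × (suc n ≤ k + t)
lemma21 n t f h φ _ notCosetPartition with t ≤? suc n
... | no  t≰1+n = 0 , [] , LinIndep-[] , [] , <⇒≤ (≰⇒> t≰1+n)
... | yes t≤1+n
  with vs , independent , good ←
         independentGoodShifts notCosetPartition (suc n ∸ t) (≤-reflexive (m∸n+n≡m t≤1+n))
  = suc n ∸ t , vs , independent , good , ≤-reflexive (sym (m∸n+n≡m t≤1+n))
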